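{- Let $S\in\{L,I\}$ and let $G$ be an S-admissible graph without isolated vertices. Then $\gamma^{\rm STD}(G)\le 2\,\gamma^{\rm S}(G)$.
   Context: Let $G=(V,E)$ be a finite simple graph, $N(v)$ the open and $N[v]=N(v)\cup\{v\}$ the closed neighborhood of $v$. A set $C\subseteq V$ is: a total-dominating set if $N(v)\cap C\neq\emptyset$ for all $v\in V$; a locating set (L-set) if the sets $N(v)\cap C$, $v\in V\setminus C$, are pairwise distinct; a closed-separating set (I-set) if the sets $N[v]\cap C$, $v\in V$, are pairwise distinct. Every graph has an L-set; $G$ is I-admissible if it has an I-set (equivalently, no two adjacent vertices have equal closed neighborhoods). An LTD-code (resp. ITD-code) is a set that is both an L-set (resp. I-set) and a total-dominating set. $\gamma^{\rm S}(G)$ and $\gamma^{\rm STD}(G)$ denote the minimum cardinalities of an S-set and of an STD-code of $G$, respectively. -}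

module Defs where

open import Data.Nat using (ℕ; _≤_)
open import Data.Bool using (Bool; true; false; _∨_)
open import Data.Fin using (Fin; _≟_)
open import Data.Fin.Subset using (Subset; _∈_; _∉_; _∩_; ∣_∣)
open import Data.Vec using (tabulate)
open import Data.Product using (Σ; ∃; _×_)
open import Relation.Binary.PropositionalEquality using (_≡_; _≢_)
open import Relation.Nullary.Decidable using (⌊_⌋)

record Graph (n : ℕ) : Set where
  field
    adj   : Fin n → Fin n → Bool
    sym   : ∀ u v → adj u v ≡ adj v u
    irrefl : ∀ v → adj v v ≡ false
open Graph public

module _ {n : ℕ} (G : Graph n) where
  N : Fin n → Subset n
  N v = tabulate (λ u → adj G v u)

  N[_] : Fin n → Subset n
  N[ v ] = tabulate (λ u → adj G v u ∨ ⌊ u ≟ v ⌋)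

  NoIsolated : Set
  NoIsolated = ∀ v → ∃ λ u → adj G v u ≡ true

  TotalDominating : Subset n → Set
  TotalDominating C = ∀ v → ∃ λ u → u ∈ (N v ∩ C)

  LSet : Subset n → Set
  LSet C = ∀ u v → u ∉ C → v ∉ C → u ≢ v → (N u ∩ C) ≢ (N v ∩ C)

  ISet : Subset n → Set
  ISet C = ∀ u v → u ≢ v → (N[ u ] ∩ C) ≢ (N[ v ] ∩ C)

data CodeType : Set where
  L I : CodeType

module _ {n : ℕ} (G : Graph n) where
  SSet : CodeType → Subset n → Set
  SSet L C = LSet G C
  SSet I C = ISet G C

  STDCode : CodeType → Subset n → Set
  STDCode S C = SSet S C × TotalDominating G C

  Admissible : CodeType → Set
  Admissible S = ∃ λ C → SSet S C

IsMinCard : {n : ℕ} → (Subset n → Set) → ℕ → Set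
IsMinCard P k = (∃ λ C → P C × ∣ C ∣ ≡ k) × (∀ C → P C → k ≤ ∣ C ∣)

IsGammaS : {n : ℕ} → Graph n → CodeType → ℕ → Set
IsGammaS G S k = IsMinCard (SSet G S) k

IsGammaSTD : {n : ℕ} → Graph n → CodeType → ℕ → Set
IsGammaSTD G S k = IsMinCard (STDCode G S) k

{-# OPTIONS --safe #-}
module Submission where

-- Pick a neighbour f v of every vertex v of an S-set C. Then C ∪ f(C) is again an
-- S-set (S-sets are closed upwards), has at most 2|C| vertices, and dominates every
-- vertex except those outside C without a neighbour in C. Such vertices all have
-- empty trace on C, so since C separates there is at most one of them, w₀. A
-- neighbour x of w₀ lies outside C and differs from w₀, hence has a neighbour v ∈ C;
-- choosing f v = x dominates w₀ as well. Minimality of C gives the bound 2γ^S.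

open import Defs hiding (sym)
open import Data.Bool using (true; false; _∨_; if_then_else_)
open import Data.Bool.Properties using (∨-identityʳ) renaming (_≟_ to _≟ᵇ_)
open import Data.Empty using (⊥-elim)
open import Data.Fin using (Fin; zero; suc; _≟_)
open import Data.Fin.Properties using (all?; any?)
open import Data.Fin.Subset
  using (Subset; inside; outside; _∈_; _∉_; _⊆_; _∩_; _∪_; ⊥; ⁅_⁆; ∣_∣; Nonempty; Empty)
open import Data.Fin.Subset.Properties
  using (_∈?_; nonempty?; anySubset?; Empty-unique; ⊆-antisym; x∈⁅x⁆; ∣⁅x⁆∣≡1; ∣⊥∣≡0;
         p⊆p∪q; q⊆p∪q; x∈p∩q⁺; x∈p∩q⁻)
open import Data.Nat using (ℕ; suc; _+_; _*_; _≤_; _<_; _<?_; s≤s)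
open import Data.Nat.Properties
  using (≤-refl; ≤-reflexive; ≤-trans; <⇒≤; ≮⇒≥; +-identityʳ; +-suc; +-monoʳ-≤; n≤1+n; module ≤-Reasoning)
open import Data.Nat.Induction using (<-wellFounded)
open import Data.Product using (∃; _×_; _,_; proj₁; proj₂)
import Data.Product as Product
open import Data.Vec using (_∷_; []; here; there)
open import Data.Vec.Properties using (≡-dec; lookup∘tabulate; []=⇒lookup; lookup⇒[]=)
open import Function using (_∘_; _on_)
open import Induction.WellFounded using (Acc; acc)
import Relation.Binary.Construct.On as On
open import Relation.Binary.PropositionalEquality
  using (_≡_; _≢_; refl; sym; trans; cong; subst)
open import Relation.Nullary using (yes; no)
open import Relation.Nullary.Decidable using (⌊_⌋; ¬?; _×-dec_; _→-dec_; decidable-stable)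
open import Relation.Unary using (Decidable)

private
  variable
    m n : ℕ

∣p∪q∣≤∣p∣+∣q∣ : (p q : Subset n) → ∣ p ∪ q ∣ ≤ ∣ p ∣ + ∣ q ∣
∣p∪q∣≤∣p∣+∣q∣ []            []            = ≤-refl
∣p∪q∣≤∣p∣+∣q∣ (inside  ∷ p) (inside  ∷ q) = s≤s (≤-trans (∣p∪q∣≤∣p∣+∣q∣ p q) (+-monoʳ-≤ ∣ p ∣ (n≤1+n ∣ q ∣)))
∣p∪q∣≤∣p∣+∣q∣ (inside  ∷ p) (outside ∷ q) = s≤s (∣p∪q∣≤∣p∣+∣q∣ p q)
∣p∪q∣≤∣p∣+∣q∣ (outside ∷ p) (inside  ∷ q) = ≤-trans (s≤s (∣p∪q∣≤∣p∣+∣q∣ p q)) (≤-reflexive (sym (+-suc ∣ p ∣ ∣ q ∣)))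
∣p∪q∣≤∣p∣+∣q∣ (outside ∷ p) (outside ∷ q) = ∣p∪q∣≤∣p∣+∣q∣ p q

∩-restrict : {p q r : Subset n} → r ⊆ q → (p ∩ q) ∩ r ≡ p ∩ r
∩-restrict {p = p} {q} {r} r⊆q = ⊆-antisym forth back
  where
  forth : (p ∩ q) ∩ r ⊆ p ∩ r
  forth x∈ with x∈p∩q⁻ (p ∩ q) r x∈
  ... | x∈p∩q , x∈r = x∈p∩q⁺ (proj₁ (x∈p∩q⁻ p q x∈p∩q) , x∈r)
  back : p ∩ r ⊆ (p ∩ q) ∩ r
  back x∈ with x∈p∩q⁻ p r x∈
  ... | x∈p , x∈r = x∈p∩q⁺ (x∈p∩q⁺ (x∈p , r⊆q x∈r) , x∈r)

∩-monoʳ-⊆ : {p q r : Subset n} → q ⊆ r → p ∩ q ⊆ p ∩ r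
∩-monoʳ-⊆ {p = p} {q} q⊆r x∈ = let x∈p , x∈q = x∈p∩q⁻ p q x∈ in x∈p∩q⁺ (x∈p , q⊆r x∈q)

image : (Fin m → Fin n) → Subset m → Subset n
image f []            = ⊥
image f (inside  ∷ p) = ⁅ f zero ⁆ ∪ image (f ∘ suc) p
image f (outside ∷ p) = image (f ∘ suc) p

∈-image : (f : Fin m → Fin n) (p : Subset m) {x : Fin m} → x ∈ p → f x ∈ image f p
∈-image f (inside  ∷ p) here      = p⊆p∪q (image (f ∘ suc) p) (x∈⁅x⁆ (f zero))
∈-image f (inside  ∷ p) (there x∈p) = q⊆p∪q ⁅ f zero ⁆ (image (f ∘ suc) p) (∈-image (f ∘ suc) p x∈p)
∈-image f (outside ∷ p) (there x∈p) = ∈-image (f ∘ suc) p x∈p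

∣image∣≤∣p∣ : (f : Fin m → Fin n) (p : Subset m) → ∣ image f p ∣ ≤ ∣ p ∣
∣image∣≤∣p∣ {n = n} f [] = ≤-reflexive (∣⊥∣≡0 n)
∣image∣≤∣p∣ f (inside ∷ p) = begin
  ∣ ⁅ f zero ⁆ ∪ image (f ∘ suc) p ∣       ≤⟨ ∣p∪q∣≤∣p∣+∣q∣ ⁅ f zero ⁆ (image (f ∘ suc) p) ⟩
  ∣ ⁅ f zero ⁆ ∣ + ∣ image (f ∘ suc) p ∣   ≡⟨ cong (_+ ∣ image (f ∘ suc) p ∣) (∣⁅x⁆∣≡1 (f zero)) ⟩
  suc ∣ image (f ∘ suc) p ∣                ≤⟨ s≤s (∣image∣≤∣p∣ (f ∘ suc) p) ⟩
  suc ∣ p ∣                                ∎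
  where open ≤-Reasoning
∣image∣≤∣p∣ f (outside ∷ p) = ∣image∣≤∣p∣ (f ∘ suc) p

∣p∪image∣≤2*∣p∣ : (f : Fin n → Fin n) (p : Subset n) → ∣ p ∪ image f p ∣ ≤ 2 * ∣ p ∣
∣p∪image∣≤2*∣p∣ f p = begin
  ∣ p ∪ image f p ∣        ≤⟨ ∣p∪q∣≤∣p∣+∣q∣ p (image f p) ⟩
  ∣ p ∣ + ∣ image f p ∣    ≤⟨ +-monoʳ-≤ ∣ p ∣ (∣image∣≤∣p∣ f p) ⟩
  ∣ p ∣ + ∣ p ∣            ≡⟨ cong (∣ p ∣ +_) (sym (+-identityʳ ∣ p ∣)) ⟩
  2 * ∣ p ∣                ∎
  where open ≤-Reasoning

module _ {P : Subset n → Set} (P? : Decidable P) where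

  private
    minCard-acc : ∀ C → Acc (_<_ on ∣_∣) C → P C → ∃ λ k → IsMinCard P k × k ≤ ∣ C ∣
    minCard-acc C (acc smaller) pC with anySubset? (λ D → P? D ×-dec (∣ D ∣ <? ∣ C ∣))
    ... | yes (D , pD , ∣D∣<∣C∣) =
      let k , k-min , k≤∣D∣ = minCard-acc D (smaller ∣D∣<∣C∣) pD
      in  k , k-min , ≤-trans k≤∣D∣ (<⇒≤ ∣D∣<∣C∣)
    ... | no none = ∣ C ∣ , ((C , pC , refl) , λ D pD → ≮⇒≥ λ ∣D∣<∣C∣ → none (D , pD , ∣D∣<∣C∣)) , ≤-refl

  minCard-exists : ∀ C → P C → ∃ λ k → IsMinCard P k × k ≤ ∣ C ∣
  minCard-exists C = minCard-acc C (On.wellFounded ∣_∣ <-wellFounded C)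

module _ {n : ℕ} (G : Graph n) where

  adj⇒∈N : ∀ {v u} → adj G v u ≡ true → u ∈ N G v
  adj⇒∈N {v} {u} vu = lookup⇒[]= u (N G v) (trans (lookup∘tabulate (adj G v) u) vu)

  ∈N⇒adj : ∀ {v u} → u ∈ N G v → adj G v u ≡ true
  ∈N⇒adj {v} {u} u∈N = trans (sym (lookup∘tabulate (adj G v) u)) ([]=⇒lookup u∈N)

  ∈N[]⇒∈N : ∀ {v u} → u ∈ N[_] G v → u ≢ v → u ∈ N G v
  ∈N[]⇒∈N {v} {u} u∈N[v] u≢v =
    adj⇒∈N (drop-loop (trans (sym (lookup∘tabulate (λ x → adj G v x ∨ ⌊ x ≟ v ⌋) u)) ([]=⇒lookup u∈N[v])))
    where
    drop-loop : adj G v u ∨ ⌊ u ≟ v ⌋ ≡ true → adj G v u ≡ true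
    drop-loop with u ≟ v
    ... | yes u≡v = ⊥-elim (u≢v u≡v)
    ... | no _    = trans (sym (∨-identityʳ (adj G v u)))

  adj⇒≢ : ∀ {v u} → adj G v u ≡ true → u ≢ v
  adj⇒≢ {v} vu refl with trans (sym vu) (irrefl G v)
  ... | ()

  Undominated : Subset n → Fin n → Set
  Undominated C w = w ∉ C × Empty (N G w ∩ C)

  undominated? : ∀ C → Decidable (Undominated C)
  undominated? C w = ¬? (w ∈? C) ×-dec ¬? (nonempty? (N G w ∩ C))

  N∩≡⊥ : ∀ {C w} → Undominated C w → N G w ∩ C ≡ ⊥
  N∩≡⊥ (_ , empty) = Empty-unique empty

  N[]∩≡⊥ : ∀ {C w} → Undominated C w → N[_] G w ∩ C ≡ ⊥
  N[]∩≡⊥ {C} {w} (w∉C , empty) = Empty-unique λ (u , u∈) →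
    let u∈N[w] , u∈C = x∈p∩q⁻ (N[_] G w) C u∈
    in  empty (u , x∈p∩q⁺ (∈N[]⇒∈N u∈N[w] (λ { refl → w∉C u∈C }) , u∈C))

  undominated-unique : ∀ S {C w₁ w₂} → SSet G S C → Undominated C w₁ → Undominated C w₂ → w₁ ≡ w₂
  undominated-unique L sC u₁ u₂ = decidable-stable (_ ≟ _) λ w₁≢w₂ →
    sC _ _ (proj₁ u₁) (proj₁ u₂) w₁≢w₂ (trans (N∩≡⊥ u₁) (sym (N∩≡⊥ u₂)))
  undominated-unique I sC u₁ u₂ = decidable-stable (_ ≟ _) λ w₁≢w₂ →
    sC _ _ w₁≢w₂ (trans (N[]∩≡⊥ u₁) (sym (N[]∩≡⊥ u₂)))

  SSet-mono : ∀ S {C D} → C ⊆ D → SSet G S C → SSet G S D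
  SSet-mono L C⊆D sC u v u∉D v∉D u≢v eq = sC u v (u∉D ∘ C⊆D) (v∉D ∘ C⊆D) u≢v
    (trans (sym (∩-restrict C⊆D)) (trans (cong (_∩ _) eq) (∩-restrict C⊆D)))
  SSet-mono I C⊆D sC u v u≢v eq = sC u v u≢v
    (trans (sym (∩-restrict C⊆D)) (trans (cong (_∩ _) eq) (∩-restrict C⊆D)))

  SSet? : ∀ S → Decidable (SSet G S)
  SSet? L C = all? λ u → all? λ v → ¬? (u ∈? C) →-dec ¬? (v ∈? C) →-dec ¬? (u ≟ v) →-dec
    ¬? (≡-dec _≟ᵇ_ (N G u ∩ C) (N G v ∩ C))
  SSet? I C = all? λ u → all? λ v → ¬? (u ≟ v) →-dec ¬? (≡-dec _≟ᵇ_ (N[_] G u ∩ C) (N[_] G v ∩ C))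

  STDCode? : ∀ S → Decidable (STDCode G S)
  STDCode? S C = SSet? S C ×-dec all? λ v → nonempty? (N G v ∩ C)

  NeighbourChoice : (Fin n → Fin n) → Set
  NeighbourChoice f = ∀ v → adj G v (f v) ≡ true

  CoversUndominated : Subset n → (Fin n → Fin n) → Set
  CoversUndominated C f = ∀ w → Undominated C w → Nonempty (N G w ∩ image f C)

  ∪image-totalDominating : ∀ {C f} → NeighbourChoice f → CoversUndominated C f →
                           TotalDominating G (C ∪ image f C)
  ∪image-totalDominating {C} {f} f-nb covers w with w ∈? C
  ... | yes w∈C = f w , x∈p∩q⁺ (adj⇒∈N (f-nb w) , q⊆p∪q C (image f C) (∈-image f C w∈C))
  ... | no w∉C with nonempty? (N G w ∩ C)
  ...   | yes (u , u∈) = u , ∩-monoʳ-⊆ (p⊆p∪q (image f C)) u∈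
  ...   | no empty     = Product.map₂ (∩-monoʳ-⊆ (q⊆p∪q C (image f C))) (covers w (w∉C , empty))

  prefer : Fin n → (Fin n → Fin n) → Fin n → Fin n
  prefer x f v = if adj G v x then x else f v

  prefer-neighbourChoice : ∀ {f} x → NeighbourChoice f → NeighbourChoice (prefer x f)
  prefer-neighbourChoice x f-nb v with adj G v x in vx
  ... | true  = vx
  ... | false = f-nb v

  prefer-hits : ∀ {f v x} → adj G v x ≡ true → prefer x f v ≡ x
  prefer-hits vx rewrite vx = refl

  prefer-covers : ∀ S {C w₀} → SSet G S C → (nb : NoIsolated G) → Undominated C w₀ →
                  CoversUndominated C (prefer (proj₁ (nb w₀)) (proj₁ ∘ nb))
  prefer-covers S {C} {w₀} sC nb u₀ w u rewrite undominated-unique S sC u u₀ =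
    x , x∈p∩q⁺ (adj⇒∈N w₀x , x∈image)
    where
    x : Fin n
    x = proj₁ (nb w₀)
    w₀x : adj G w₀ x ≡ true
    w₀x = proj₂ (nb w₀)
    x∉C : x ∉ C
    x∉C x∈C = proj₂ u₀ (x , x∈p∩q⁺ (adj⇒∈N w₀x , x∈C))
    x-dominated : Nonempty (N G x ∩ C)
    x-dominated = decidable-stable (nonempty? (N G x ∩ C)) λ empty →
      adj⇒≢ w₀x (undominated-unique S sC (x∉C , empty) u₀)
    f : Fin n → Fin n
    f = prefer x (proj₁ ∘ nb)
    x∈image : x ∈ image f C
    x∈image =
      let v , v∈ = x-dominated
          v∈N , v∈C = x∈p∩q⁻ (N G x) C v∈
          vx = trans (sym (Graph.sym G x v)) (∈N⇒adj v∈N)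
      in  subst (_∈ image f C) (prefer-hits {proj₁ ∘ nb} vx) (∈-image f C v∈C)

  coveringChoice : ∀ S {C} → SSet G S C → NoIsolated G →
                   ∃ λ f → NeighbourChoice f × CoversUndominated C f
  coveringChoice S {C} sC nb with any? (undominated? C)
  ... | yes (w₀ , u₀) = _ , prefer-neighbourChoice _ (proj₂ ∘ nb) , prefer-covers S sC nb u₀
  ... | no none       = proj₁ ∘ nb , proj₂ ∘ nb , λ w u → ⊥-elim (none (w , u))

  SSet⇒∃STDCode≤2* : ∀ S {C} → NoIsolated G → SSet G S C → ∃ λ D → STDCode G S D × ∣ D ∣ ≤ 2 * ∣ C ∣
  SSet⇒∃STDCode≤2* S {C} nb sC =
    let f , f-nb , f-covers = coveringChoice S sC nb
    in  C ∪ image f C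
      , (SSet-mono S (p⊆p∪q (image f C)) sC , ∪image-totalDominating f-nb f-covers)
      , ∣p∪image∣≤2*∣p∣ f C

theorem5 : (S : CodeType) {n : ℕ} (G : Graph n) →
    Admissible G S → NoIsolated G →
    (k : ℕ) → IsGammaS G S k →
    ∃ λ m → IsGammaSTD G S m × m ≤ 2 * k
theorem5 S G _ nb k ((C , sC , ∣C∣≡k) , _) =
  let D , D-code , ∣D∣≤2*∣C∣ = SSet⇒∃STDCode≤2* G S nb sC
      m , m-min , m≤∣D∣ = minCard-exists (STDCode? G S) D D-code
  in  m , m-min , ≤-trans m≤∣D∣ (subst (λ c → ∣ D ∣ ≤ 2 * c) ∣C∣≡k ∣D∣≤2*∣C∣)
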